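{- Let $\mathcal{A}$ be a strongly connected VASS such that the call $\mathrm{Decompose}(\mathcal{A})$ (described in the context) makes a recursive call $\mathrm{Decompose}(\mathcal{A}')$ for some SCC $\mathcal{A}'$ of $(Q,T_f)$. Then $\dim(\mathrm{cone}(\mathit{Inc}_{\mathcal{A}}))>\dim(\mathrm{cone}(\mathit{Inc}_{\mathcal{A}'}))$.
   Context: A $d$-dimensional VASS is a pair $\mathcal{A}=(Q,T)$ with $Q$ a finite nonempty set of states and $T\subseteq Q\times\mathbb{Z}^d\times Q$ a finite set of transitions such that every state has an outgoing transition. A finite path is $p_0,\mathbf{u}_1,p_1,\dots,\mathbf{u}_n,p_n$ with $n\ge1$ and $(p_i,\mathbf{u}_{i+1},p_{i+1})\in T$; it is a cycle if $p_0=p_n$, simple if moreover $p_1,\dots,p_{n-1}$ are pairwise distinct; its effect is $\mathbf{u}_1+\dots+\mathbf{u}_n$. $\mathit{Inc}_{\mathcal{A}}$ is the set of effects of simple cycles of $\mathcal{A}$. For finite $U\subseteq\mathbb{R}^d$, $\mathrm{cone}(U)$ is the set of non-negative real combinations of elements of $U$; the dimension of a cone is the dimension of the smallest vector space containing it. A sub-VASS is a VASS $(Q',T')$ with $Q'\subseteq Q$, $T'\subseteq T$; strongly connected means a path between any two states; an SCC of a graph $(Q,T')$ is a maximal strongly connected sub-VASS of it. A linear map is $f(p\mathbf{v})=\mathbf{c}_f^\top\mathbf{v}+\mathbf{w}_f(p)$ with $\mathbf{c}_f\in\mathbb{Q}^d$, $\mathbf{w}_f\in\mathbb{Q}^Q$;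 a transition $(p,\mathbf{u},q)$ is $f$-ranked if $\mathbf{c}_f^\top\mathbf{u}+\mathbf{w}_f(q)\le\mathbf{w}_f(p)-1$ and $f$-neutral if $\mathbf{c}_f^\top\mathbf{u}+\mathbf{w}_f(q)=\mathbf{w}_f(p)$. A QRF is a linear map with $\mathbf{c}_f\ge\vec0$ such that every transition is $f$-ranked or $f$-neutral. $\mathrm{Decompose}(\mathcal{A})$: pick a QRF $f$ maximizing the number of $f$-ranked transitions; $T_f:=$ set of $f$-neutral transitions; if $T_f$ contains all transitions return $\infty$; if $T_f=\emptyset$ return $1$; otherwise with $\mathcal{A}_1,\dots,\mathcal{A}_\ell$ all SCCs of $(Q,T_f)$ return $1+\max_i\mathrm{Decompose}(\mathcal{A}_i)$. -}

module Defs where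

open import Data.Nat using (ℕ; zero; suc; _<_)
open import Data.Fin using (Fin; zero; suc)
open import Data.Integer using (ℤ)
open import Data.Rational using (ℚ; 0ℚ; 1ℚ; _/_; _≤_; _≤?_)
  renaming (_+_ to _+ℚ_; _*_ to _*ℚ_; _-_ to _-ℚ_)
open import Data.Vec using (Vec; []; _∷_; replicate; zipWith; map; foldr)
open import Data.List using (List; []; _∷_; length; filter)
open import Data.List.Membership.Propositional using (_∈_)
open import Data.List.Relation.Unary.Unique.Propositional using (Unique)
open import Data.Product using (Σ; ∃; ∃-syntax; _×_; _,_; proj₁; proj₂)
open import Relation.Binary.PropositionalEquality using (_≡_)
open import Relation.Nullary using (¬_)
open import Relation.Unary using (Pred)
import Level

Vecℤ : ℕ → Set
Vecℤ d = Vec ℤ d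

Vecℚ : ℕ → Set
Vecℚ d = Vec ℚ d

toℚ : ℤ → ℚ
toℚ z = z / 1

_+ℤv_ : ∀ {d} → Vecℤ d → Vecℤ d → Vecℤ d
_+ℤv_ = zipWith Data.Integer._+_

_+v_ : ∀ {d} → Vecℚ d → Vecℚ d → Vecℚ d
_+v_ = zipWith _+ℚ_

_·v_ : ∀ {d} → ℚ → Vecℚ d → Vecℚ d
a ·v v = map (a *ℚ_) v

0v : ∀ {d} → Vecℚ d
0v = replicate _ 0ℚ

dot : ∀ {d} → Vecℚ d → Vecℤ d → ℚ
dot c u = foldr _ _+ℚ_ 0ℚ (zipWith (λ ci ui → ci *ℚ toℚ ui) c u)

lincomb : ∀ {d} (m : ℕ) → (Fin m → ℚ) → (Fin m → Vecℚ d) → Vecℚ d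
lincomb zero    a w = 0v
lincomb (suc m) a w = (a zero ·v w zero) +v lincomb m (λ i → a (suc i)) (λ i → w (suc i))

InCone : ∀ {d} → Pred (Vecℚ d) Level.zero → Pred (Vecℚ d) Level.zero
InCone {d} U v = ∃[ m ] Σ (Fin m → ℚ) λ a → Σ (Fin m → Vecℚ d) λ w →
  (∀ i → 0ℚ ≤ a i) × (∀ i → U (w i)) × (v ≡ lincomb m a w)

InSpan : ∀ {d} → Pred (Vecℚ d) Level.zero → Pred (Vecℚ d) Level.zero
InSpan {d} S v = ∃[ m ] Σ (Fin m → ℚ) λ a → Σ (Fin m → Vecℚ d) λ w →
  (∀ i → S (w i)) × (v ≡ lincomb m a w)

LinIndep : ∀ {d} (k : ℕ) → (Fin k → Vecℚ d) → Set
LinIndep k w = ∀ (a : Fin k → ℚ) → lincomb k a w ≡ 0v → ∀ i → a i ≡ 0ℚ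

SpanDim : ∀ {d} → Pred (Vecℚ d) Level.zero → ℕ → Set
SpanDim {d} S k =
  (Σ (Fin k → Vecℚ d) λ w → (∀ i → InSpan S (w i)) × LinIndep k w)
  × (∀ (w : Fin (suc k) → Vecℚ d) → (∀ i → InSpan S (w i)) → ¬ LinIndep (suc k) w)

ConeDim : ∀ {d} → Pred (Vecℚ d) Level.zero → ℕ → Set
ConeDim U k = SpanDim (InCone U) k

Trans : ℕ → ℕ → Set
Trans d n = Fin n × Vecℤ d × Fin n

src : ∀ {d n} → Trans d n → Fin n
src (p , _ , _) = p

eff : ∀ {d n} → Trans d n → Vecℤ d
eff (_ , u , _) = u

tgt : ∀ {d n} → Trans d n → Fin n
tgt (_ , _ , q) = q

-- A (sub-)VASS given by a set of states Q' ⊆ Fin n and a set of transitions T'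
record Graph (d n : ℕ) : Set₁ where
  field
    St : Fin n → Set
    Tr : Trans d n → Set
open Graph public

fullGraph : ∀ {d n} → List (Trans d n) → Graph d n
fullGraph T = record { St = λ _ → Data.Unit.⊤ ; Tr = λ t → t ∈ T }
  where import Data.Unit

graphOn : ∀ {d n} → (Trans d n → Set) → Graph d n
graphOn P = record { St = λ _ → Data.Unit.⊤ ; Tr = P }
  where import Data.Unit

IsVASS : ∀ {d n} → Graph d n → Set
IsVASS {d} {n} G =
  (∃[ p ] St G p)
  × (∀ t → Tr G t → St G (src t) × St G (tgt t))
  × (∀ p → St G p → ∃[ u ] ∃[ q ] Tr G (p , u , q))

IsSubVASS : ∀ {d n} → Graph d n → Graph d n → Set
IsSubVASS G H = IsVASS G × (∀ p → St G p → St H p) × (∀ t → Tr G t → Tr H t)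

data PathIn {d n} (G : Graph d n) : Fin n → List (Trans d n) → Fin n → Set where
  one  : ∀ {p u q} → Tr G (p , u , q) → PathIn G p ((p , u , q) ∷ []) q
  step : ∀ {p u r q ts} → Tr G (p , u , r) → PathIn G r ts q →
         PathIn G p ((p , u , r) ∷ ts) q

-- intermediate states p_1, …, p_{n-1} of a path given by its transitions
inner : ∀ {d n} → List (Trans d n) → List (Fin n)
inner []             = []
inner (t ∷ [])       = []
inner (t ∷ t′ ∷ ts)  = tgt t ∷ inner (t′ ∷ ts)

effect : ∀ {d n} → List (Trans d n) → Vecℤ d
effect []       = replicate _ (Data.Integer.+ 0)
effect (t ∷ ts) = eff t +ℤv effect ts

SimpleCycle : ∀ {d n} → Graph d n → Fin n → List (Trans d n) → Set
SimpleCycle G p ts = PathIn G p ts p × Unique (inner ts)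

Inc : ∀ {d n} → Graph d n → Pred (Vecℚ d) Level.zero
Inc {d} {n} G v = Σ (Fin n) λ p → Σ (List (Trans d n)) λ ts →
  SimpleCycle G p ts × (v ≡ map toℚ (effect ts))

StronglyConnected : ∀ {d n} → Graph d n → Set
StronglyConnected {d} {n} G =
  ∀ p q → St G p → St G q → Σ (List (Trans d n)) λ ts → PathIn G p ts q

IsSCC : ∀ {d n} → Graph d n → Graph d n → Set₁
IsSCC {d} {n} G H =
  IsSubVASS G H × StronglyConnected G
  × (∀ (G′ : Graph d n) → IsSubVASS G′ H → StronglyConnected G′ →
       (∀ p → St G p → St G′ p) → (∀ t → Tr G t → Tr G′ t) →
       (∀ p → St G′ p → St G p) × (∀ t → Tr G′ t → Tr G t))

record LinMap (d n : ℕ) : Set where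
  field
    c : Vecℚ d
    w : Fin n → ℚ
open LinMap public

Ranked : ∀ {d n} → LinMap d n → Trans d n → Set
Ranked f (p , u , q) = dot (c f) u +ℚ w f q ≤ w f p -ℚ 1ℚ

Neutral : ∀ {d n} → LinMap d n → Trans d n → Set
Neutral f (p , u , q) = dot (c f) u +ℚ w f q ≡ w f p

ranked? : ∀ {d n} (f : LinMap d n) (t : Trans d n) → Relation.Nullary.Dec (Ranked f t)
ranked? f (p , u , q) = (dot (c f) u +ℚ w f q) ≤? (w f p -ℚ 1ℚ)

NonNegVec : ∀ {d} → Vecℚ d → Set
NonNegVec v = Data.Vec.Relation.Unary.All.All (0ℚ ≤_) v
  where import Data.Vec.Relation.Unary.All

IsQRF : ∀ {d n} → List (Trans d n) → LinMap d n → Set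
IsQRF T f = NonNegVec (c f) × (∀ t → t ∈ T → Data.Sum._⊎_ (Ranked f t) (Neutral f t))
  where import Data.Sum

numRanked : ∀ {d n} → List (Trans d n) → LinMap d n → ℕ
numRanked T f = length (filter (ranked? f) T)

IsMaxQRF : ∀ {d n} → List (Trans d n) → LinMap d n → Set
IsMaxQRF T f = IsQRF T f × (∀ g → IsQRF T g → numRanked T g Data.Nat.≤ numRanked T f)

NeutralTrans : ∀ {d n} → List (Trans d n) → LinMap d n → Trans d n → Set
NeutralTrans T f t = t ∈ T × Neutral f t

-- Decompose(A) with A = (Fin n, T), having chosen the maximizing QRF f,
-- makes the recursive call Decompose(A′)
MakesRecursiveCall : ∀ {d n} → List (Trans d n) → LinMap d n → Graph d n → Set₁
MakesRecursiveCall T f A′ =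
  IsMaxQRF T f
  × (¬ (∀ t → t ∈ T → Neutral f t))
  × (∃ λ t → NeutralTrans T f t)
  × IsSCC A′ (graphOn (NeutralTrans T f))

-- Every simple cycle of A′ uses only f-neutral transitions, so its effect v
-- satisfies c_fᵀ v = 0 by telescoping the potential w_f along the cycle: the cone
-- of A′ lies in the hyperplane c_fᵀ = 0. Since f is not neutral everywhere, it
-- ranks some transition t; closing t by a path back through the strongly
-- connected A and cutting out repeated states gives a simple cycle of A with
-- c_fᵀ v ≤ -1. This v, added to a basis of the span of cone(Inc_A′) (which lies
-- in that of cone(Inc_A)), is still independent, so the dimension drops.
-- Both dimensions exist because Inc of a finite VASS is a finite set, and
-- finite families over ℚ have bases (Gaussian elimination); for A′ this uses
-- that an SCC is the decidable set of states mutually reachable with one of them.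

module Submission where

open import Defs
open import Algebra.Bundles using (CommutativeRing)
open import Data.Empty using (⊥-elim)
open import Data.Fin as Fin using (Fin; zero; suc; punchIn; punchOut)
open import Data.Fin.Properties using (any?; punchIn-punchOut; pigeonhole; <⇒≢)
import Data.Integer as ℤ
import Data.Integer.Properties as ℤ
open import Data.List as List using (List; []; _∷_; length; _++_; filter)
open import Data.List.Properties using (length-map)
open import Data.List.Membership.Propositional using (_∈_; lose; find)
open import Data.List.Membership.Propositional.Properties
  using (∈-lookup; ∈-map⁺; ∈-map⁻; ∈-filter⁺; ∈-filter⁻; ∈-cartesianProductWith⁺)
import Data.List.Membership.DecPropositional as DecMembership
open import Data.List.Relation.Unary.All as All using (All; []; _∷_)
open import Data.List.Relation.Unary.All.Properties using (¬Any⇒All¬; ¬All⇒Any¬)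
open import Data.List.Relation.Unary.AllPairs using ([]; _∷_)
import Data.List.Relation.Unary.Any as Any
open import Data.List.Relation.Unary.Any using (here; there)
open import Data.List.Relation.Unary.Any.Properties using (lookup-index)
open import Data.List.Relation.Unary.Unique.Propositional using (Unique)
open import Data.List.Relation.Unary.Unique.DecPropositional using (unique?)
open import Data.Nat as ℕ using (ℕ; zero; suc; z≤n; s≤s)
open import Data.Nat.Properties using (m≤n⇒m≤1+n; <-irrefl; ≰⇒>)
open import Data.Product using (Σ; ∃-syntax; _×_; _,_; proj₁; proj₂)
import Data.Product.Properties as Product
open import Data.Rational using (ℚ; 0ℚ; 1ℚ; _+_; _*_; -_; _-_; 1/_; ≢-nonZero; _≤_; _<_)
import Data.Rational.Properties as ℚ
open import Data.Rational.Properties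
  using (+-*-commutativeRing; _≟_; +-assoc; +-identityˡ; +-identityʳ; *-assoc; *-zeroˡ; *-zeroʳ; *-identityʳ;
         *-inverseˡ; *-inverseʳ; ≤-reflexive; ≤-trans; <⇒≤; ≤-<-trans; <-≤-trans; +-monoʳ-≤; +-monoʳ-<;
         negative⁻¹; nonNegative⁻¹; toℚᵘ-injective; toℚᵘ-fromℚᵘ; toℚᵘ-homo-+)
open import Data.Rational.Solver using (module +-*-Solver)
import Data.Rational.Unnormalised as ℚᵘ
import Data.Rational.Unnormalised.Properties as ℚᵘ
open import Data.Sum using (_⊎_; inj₁; inj₂)
open import Data.Vec as Vec using ([]; _∷_; lookup; tail)
import Data.Vec.Properties as Vec
open import Data.Vec.Properties using (lookup-zipWith; lookup-map; lookup-replicate; lookup∘tabulate; ∷-injectiveʳ)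
import Data.Vec.Functional as Vector
open import Data.Vec.Functional.Properties using (insertAt-lookup; insertAt-punchIn)
open import Function using (_∘_)
import Level
open import Relation.Binary.Definitions using (DecidableEquality)
open import Relation.Binary.PropositionalEquality
open import Relation.Nullary using (¬_; Dec; yes; no; ¬?)
open import Relation.Nullary.Decidable using (decidable-stable; _×-dec_)
open import Relation.Unary using (Pred; Decidable; _⊆_; _≐_)

open import Algebra.Properties.Group ℚ.+-0-group using (identityˡ-unique)
open import Algebra.Properties.Semiring.Sum (CommutativeRing.semiring +-*-commutativeRing)
  using (sum-syntax; sum-cong-≗; sum-remove; sum-replicate-zero; ∑-comm; ∑-distrib-+;
         *-distribˡ-sum; *-distribʳ-sum)

open +-*-Solver
open ≡-Reasoning

-- Linear algebra over ℚ

lookup-ext : ∀ {d} {x y : Vecℚ d} → (∀ j → lookup x j ≡ lookup y j) → x ≡ y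
lookup-ext {x = []}     {[]}     _ = refl
lookup-ext {x = x ∷ xs} {y ∷ ys} e = cong₂ _∷_ (e zero) (lookup-ext (e ∘ suc))

lookup-+v : ∀ {d} (x y : Vecℚ d) j → lookup (x +v y) j ≡ lookup x j + lookup y j
lookup-+v x y j = lookup-zipWith _+_ j x y

lookup-·v : ∀ {d} r (x : Vecℚ d) j → lookup (r ·v x) j ≡ r * lookup x j
lookup-·v r x j = lookup-map j (r *_) x

*-cancelʳ-nonZero : ∀ a p → p ≢ 0ℚ → a * p ≡ 0ℚ → a ≡ 0ℚ
*-cancelʳ-nonZero a p p≢0 ap≡0 = begin
  a                ≡⟨ *-identityʳ a ⟨
  a * 1ℚ           ≡⟨ cong (a *_) (*-inverseʳ p) ⟨
  a * (p * 1/ p)   ≡⟨ *-assoc a p (1/ p) ⟨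
  a * p * 1/ p     ≡⟨ cong (_* 1/ p) ap≡0 ⟩
  0ℚ * 1/ p        ≡⟨ *-zeroˡ (1/ p) ⟩
  0ℚ               ∎
  where instance _ = ≢-nonZero p≢0

∑-vanishing : ∀ m (a x : Fin m → ℚ) → (∀ i → x i ≡ 0ℚ) → ∑[ i < m ] (a i * x i) ≡ 0ℚ
∑-vanishing m a x x≡0 =
  trans (sum-cong-≗ (λ i → trans (cong (a i *_) (x≡0 i)) (*-zeroʳ (a i)))) (sum-replicate-zero m)

lookup-lincomb : ∀ {d} m (a : Fin m → ℚ) (w : Fin m → Vecℚ d) j →
                 lookup (lincomb m a w) j ≡ ∑[ i < m ] (a i * lookup (w i) j)
lookup-lincomb zero    a w j = lookup-replicate j 0ℚ
lookup-lincomb (suc m) a w j = begin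
  lookup ((a zero ·v w zero) +v lincomb m (a ∘ suc) (w ∘ suc)) j
    ≡⟨ lookup-+v (a zero ·v w zero) _ j ⟩
  lookup (a zero ·v w zero) j + lookup (lincomb m (a ∘ suc) (w ∘ suc)) j
    ≡⟨ cong₂ _+_ (lookup-·v (a zero) (w zero) j) (lookup-lincomb m (a ∘ suc) (w ∘ suc) j) ⟩
  a zero * lookup (w zero) j + ∑[ i < m ] (a (suc i) * lookup (w (suc i)) j) ∎

lincomb-cong : ∀ {d} m {a a′ : Fin m → ℚ} {w w′ : Fin m → Vecℚ d} →
               (∀ i → a i ≡ a′ i) → (∀ i → w i ≡ w′ i) → lincomb m a w ≡ lincomb m a′ w′
lincomb-cong zero    _  _  = refl
lincomb-cong (suc m) ea ew =
  cong₂ _+v_ (cong₂ _·v_ (ea zero) (ew zero)) (lincomb-cong m (ea ∘ suc) (ew ∘ suc))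

lincomb-zeroˡ : ∀ {d} m (w : Fin m → Vecℚ d) → lincomb m (λ _ → 0ℚ) w ≡ 0v
lincomb-zeroˡ m w = lookup-ext λ j → begin
  lookup (lincomb m (λ _ → 0ℚ) w) j  ≡⟨ lookup-lincomb m _ w j ⟩
  ∑[ i < m ] (0ℚ * lookup (w i) j)   ≡⟨ sum-cong-≗ (λ i → *-zeroˡ (lookup (w i) j)) ⟩
  ∑[ i < m ] 0ℚ                      ≡⟨ sum-replicate-zero m ⟩
  0ℚ                                 ≡⟨ lookup-replicate j 0ℚ ⟨
  lookup 0v j                        ∎

lincomb-suc-zero : ∀ {d} k (a : Fin (suc k) → ℚ) (w : Fin (suc k) → Vecℚ d) →
                   a zero ≡ 0ℚ → lincomb (suc k) a w ≡ lincomb k (a ∘ suc) (w ∘ suc)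
lincomb-suc-zero k a w a₀≡0 = lookup-ext λ j → begin
  lookup ((a zero ·v w zero) +v lincomb k (a ∘ suc) (w ∘ suc)) j
    ≡⟨ lookup-+v (a zero ·v w zero) _ j ⟩
  lookup (a zero ·v w zero) j + lookup (lincomb k (a ∘ suc) (w ∘ suc)) j
    ≡⟨ cong (_+ lookup (lincomb k (a ∘ suc) (w ∘ suc)) j) (trans (lookup-·v (a zero) (w zero) j)
         (trans (cong (_* lookup (w zero) j) a₀≡0) (*-zeroˡ (lookup (w zero) j)))) ⟩
  0ℚ + lookup (lincomb k (a ∘ suc) (w ∘ suc)) j
    ≡⟨ +-identityˡ _ ⟩
  lookup (lincomb k (a ∘ suc) (w ∘ suc)) j ∎

lincomb-∷ : ∀ {d} m (a x : Fin m → ℚ) (v : Fin m → Vecℚ d) →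
            lincomb m a (λ i → x i ∷ v i) ≡ (∑[ i < m ] (a i * x i)) ∷ lincomb m a v
lincomb-∷ zero    a x v = refl
lincomb-∷ (suc m) a x v rewrite lincomb-∷ m (a ∘ suc) (x ∘ suc) (v ∘ suc) = refl

lincomb-0∷ : ∀ {d} m (a : Fin m → ℚ) (v : Fin m → Vecℚ d) →
             lincomb m a (λ i → 0ℚ ∷ v i) ≡ 0ℚ ∷ lincomb m a v
lincomb-0∷ m a v =
  trans (lincomb-∷ m a (λ _ → 0ℚ) v) (cong (_∷ lincomb m a v) (∑-vanishing m a _ (λ _ → refl)))

≡0∷tail : ∀ {d} (x : Vecℚ (suc d)) → lookup x zero ≡ 0ℚ → x ≡ 0ℚ ∷ tail x
≡0∷tail (x ∷ xs) x≡0 = cong (_∷ xs) x≡0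

lincomb-headless : ∀ {d} m (a : Fin m → ℚ) (w : Fin m → Vecℚ (suc d)) →
                   (∀ i → lookup (w i) zero ≡ 0ℚ) → lincomb m a w ≡ 0ℚ ∷ lincomb m a (tail ∘ w)
lincomb-headless m a w heads≡0 =
  trans (lincomb-cong m (λ _ → refl) (λ i → ≡0∷tail (w i) (heads≡0 i))) (lincomb-0∷ m a (tail ∘ w))

lincomb-lincomb : ∀ {d} k m (a : Fin k → ℚ) (C : Fin k → Fin m → ℚ) (b : Fin m → Vecℚ d) →
                  lincomb k a (λ i → lincomb m (C i) b) ≡ lincomb m (λ l → ∑[ i < k ] (a i * C i l)) b
lincomb-lincomb k m a C b = lookup-ext λ j → begin
  lookup (lincomb k a (λ i → lincomb m (C i) b)) j
    ≡⟨ lookup-lincomb k a _ j ⟩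
  ∑[ i < k ] (a i * lookup (lincomb m (C i) b) j)
    ≡⟨ sum-cong-≗ (λ i → cong (a i *_) (lookup-lincomb m (C i) b j)) ⟩
  ∑[ i < k ] (a i * ∑[ l < m ] (C i l * lookup (b l) j))
    ≡⟨ sum-cong-≗ (λ i → *-distribˡ-sum (a i) (λ l → C i l * lookup (b l) j)) ⟩
  ∑[ i < k ] ∑[ l < m ] (a i * (C i l * lookup (b l) j))
    ≡⟨ ∑-comm (λ i l → a i * (C i l * lookup (b l) j)) ⟩
  ∑[ l < m ] ∑[ i < k ] (a i * (C i l * lookup (b l) j))
    ≡⟨ sum-cong-≗ (λ l → sum-cong-≗ (λ i → *-assoc (a i) (C i l) _)) ⟨
  ∑[ l < m ] ∑[ i < k ] (a i * C i l * lookup (b l) j)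
    ≡⟨ sum-cong-≗ (λ l → *-distribʳ-sum (lookup (b l) j) (λ i → a i * C i l)) ⟨
  ∑[ l < m ] (∑[ i < k ] (a i * C i l) * lookup (b l) j)
    ≡⟨ lookup-lincomb m _ b j ⟨
  lookup (lincomb m (λ l → ∑[ i < k ] (a i * C i l)) b) j ∎

lincomb-insertAt : ∀ {d} m (a : Fin m → ℚ) (i₀ : Fin (suc m)) x (w : Fin (suc m) → Vecℚ d) →
                   lincomb (suc m) (Vector.insertAt a i₀ x) w
                     ≡ (x ·v w i₀) +v lincomb m a (Vector.removeAt w i₀)
lincomb-insertAt m a i₀ x w = lookup-ext λ j → begin
  lookup (lincomb (suc m) a′ w) j
    ≡⟨ lookup-lincomb (suc m) a′ w j ⟩
  ∑[ i < suc m ] (a′ i * lookup (w i) j)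
    ≡⟨ sum-remove {i = i₀} (λ i → a′ i * lookup (w i) j) ⟩
  a′ i₀ * lookup (w i₀) j + ∑[ i < m ] (a′ (punchIn i₀ i) * lookup (w (punchIn i₀ i)) j)
    ≡⟨ cong₂ _+_ (cong (_* lookup (w i₀) j) (insertAt-lookup a i₀ x))
                 (sum-cong-≗ (λ i → cong (_* lookup (w (punchIn i₀ i)) j) (insertAt-punchIn a i₀ x i))) ⟩
  x * lookup (w i₀) j + ∑[ i < m ] (a i * lookup (w (punchIn i₀ i)) j)
    ≡⟨ cong₂ _+_ (lookup-·v x (w i₀) j) (lookup-lincomb m a _ j) ⟨
  lookup (x ·v w i₀) j + lookup (lincomb m a (Vector.removeAt w i₀)) j
    ≡⟨ lookup-+v (x ·v w i₀) _ j ⟨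
  lookup ((x ·v w i₀) +v lincomb m a (Vector.removeAt w i₀)) j ∎
  where a′ = Vector.insertAt a i₀ x

lincomb-+·v : ∀ {d} m (a r : Fin m → ℚ) (x : Fin m → Vecℚ d) y →
              lincomb m a (λ i → x i +v (r i ·v y)) ≡ ((∑[ i < m ] (a i * r i)) ·v y) +v lincomb m a x
lincomb-+·v m a r x y = lookup-ext λ j → begin
  lookup (lincomb m a (λ i → x i +v (r i ·v y))) j
    ≡⟨ lookup-lincomb m a _ j ⟩
  ∑[ i < m ] (a i * lookup (x i +v (r i ·v y)) j)
    ≡⟨ sum-cong-≗ (λ i → cong (a i *_)
         (trans (lookup-+v (x i) _ j) (cong (lookup (x i) j +_) (lookup-·v (r i) y j)))) ⟩
  ∑[ i < m ] (a i * (lookup (x i) j + r i * lookup y j))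
    ≡⟨ sum-cong-≗ (λ i → solve 4 (λ a x r y → a :* (x :+ r :* y) := a :* r :* y :+ a :* x)
                                   refl (a i) (lookup (x i) j) (r i) (lookup y j)) ⟩
  ∑[ i < m ] (a i * r i * lookup y j + a i * lookup (x i) j)
    ≡⟨ ∑-distrib-+ (λ i → a i * r i * lookup y j) (λ i → a i * lookup (x i) j) ⟩
  ∑[ i < m ] (a i * r i * lookup y j) + ∑[ i < m ] (a i * lookup (x i) j)
    ≡⟨ cong₂ _+_ (*-distribʳ-sum (lookup y j) (λ i → a i * r i)) (lookup-lincomb m a x j) ⟨
  s * lookup y j + lookup (lincomb m a x) j
    ≡⟨ cong₂ _+_ (lookup-·v s y j) refl ⟨
  lookup (s ·v y) j + lookup (lincomb m a x) j
    ≡⟨ lookup-+v (s ·v y) (lincomb m a x) j ⟨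
  lookup ((s ·v y) +v lincomb m a x) j ∎
  where s = ∑[ i < m ] (a i * r i)

InSpanOf : ∀ {d m} → (Fin m → Vecℚ d) → Pred (Vecℚ d) Level.zero
InSpanOf {m = m} L v = Σ (Fin m → ℚ) λ a → v ≡ lincomb m a L

span-lincomb : ∀ {d m k} {L : Fin m → Vecℚ d} (a : Fin k → ℚ) {w : Fin k → Vecℚ d} →
               (∀ i → InSpanOf L (w i)) → InSpanOf L (lincomb k a w)
span-lincomb {m = m} {k} {L} a w∈L =
  (λ l → ∑[ i < k ] (a i * proj₁ (w∈L i) l)) ,
  trans (lincomb-cong k (λ _ → refl) (proj₂ ∘ w∈L)) (lincomb-lincomb k m a (proj₁ ∘ w∈L) L)

span-member : ∀ {d m} (L : Fin m → Vecℚ d) i → InSpanOf L (L i)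
span-member {m = suc m} L i = Vector.insertAt (λ _ → 0ℚ) i 1ℚ , sym (begin
  lincomb (suc m) (Vector.insertAt (λ _ → 0ℚ) i 1ℚ) L
    ≡⟨ lincomb-insertAt m (λ _ → 0ℚ) i 1ℚ L ⟩
  (1ℚ ·v L i) +v lincomb m (λ _ → 0ℚ) (Vector.removeAt L i)
    ≡⟨ cong ((1ℚ ·v L i) +v_) (lincomb-zeroˡ m _) ⟩
  (1ℚ ·v L i) +v 0v
    ≡⟨ lookup-ext (λ j → begin
         lookup ((1ℚ ·v L i) +v 0v) j    ≡⟨ lookup-+v (1ℚ ·v L i) 0v j ⟩
         lookup (1ℚ ·v L i) j + lookup 0v j
           ≡⟨ cong₂ _+_ (lookup-·v 1ℚ (L i) j) (lookup-replicate j 0ℚ) ⟩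
         1ℚ * lookup (L i) j + 0ℚ        ≡⟨ solve 1 (λ x → con 1ℚ :* x :+ con 0ℚ := x) refl (lookup (L i) j) ⟩
         lookup (L i) j                  ∎) ⟩
  L i ∎)

Linear : ∀ {d} → (Vecℚ d → ℚ) → Set
Linear {d} φ = ∀ m (a : Fin m → ℚ) (w : Fin m → Vecℚ d) → φ (lincomb m a w) ≡ ∑[ i < m ] (a i * φ (w i))

linear-vanishing : ∀ {d} (φ : Vecℚ d → ℚ) → Linear φ → ∀ m (a : Fin m → ℚ) (w : Fin m → Vecℚ d) →
                   (∀ i → φ (w i) ≡ 0ℚ) → φ (lincomb m a w) ≡ 0ℚ
linear-vanishing φ lin m a w φw≡0 = trans (lin m a w) (∑-vanishing m a (φ ∘ w) φw≡0)

head-linear : ∀ {d} → Linear {suc d} (λ x → lookup x zero)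
head-linear m a w = lookup-lincomb m a w zero

∷-independent : ∀ {d k} (φ : Vecℚ d → ℚ) → Linear φ → {v : Vecℚ d} {b : Fin k → Vecℚ d} →
                (∀ i → φ (b i) ≡ 0ℚ) → φ v ≢ 0ℚ → LinIndep k b → LinIndep (suc k) (v Vector.∷ b)
∷-independent {k = k} φ lin {v} {b} φb≡0 φv≢0 b-indep a comb≡0 = λ where
    zero    → a₀≡0
    (suc i) → b-indep (a ∘ suc) (trans (sym (lincomb-suc-zero k a (v Vector.∷ b) a₀≡0)) comb≡0) i
  where
  a₀≡0 : a zero ≡ 0ℚ
  a₀≡0 = *-cancelʳ-nonZero (a zero) (φ v) φv≢0 (begin
    a zero * φ v
      ≡⟨ +-identityʳ _ ⟨
    a zero * φ v + 0ℚ
      ≡⟨ cong (a zero * φ v +_) (∑-vanishing k (a ∘ suc) (φ ∘ b) φb≡0) ⟨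
    a zero * φ v + ∑[ i < k ] (a (suc i) * φ (b i))
      ≡⟨ lin (suc k) a (v Vector.∷ b) ⟨
    φ (lincomb (suc k) a (v Vector.∷ b))
      ≡⟨ cong φ comb≡0 ⟩
    φ 0v
      ≡⟨ lin 0 (λ ()) (λ ()) ⟩
    0ℚ ∎)

0∷-independent : ∀ {d m} {v : Fin m → Vecℚ d} → LinIndep m v → LinIndep m (λ i → 0ℚ ∷ v i)
0∷-independent {m = m} {v} v-indep a comb≡0 =
  v-indep a (∷-injectiveʳ (trans (sym (lincomb-0∷ m a v)) comb≡0))

tail-independent : ∀ {d m} {w : Fin m → Vecℚ (suc d)} → (∀ i → lookup (w i) zero ≡ 0ℚ) →
                   LinIndep m w → LinIndep m (tail ∘ w)
tail-independent {m = m} {w} heads≡0 w-indep a comb≡0 =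
  w-indep a (trans (lincomb-headless m a w heads≡0) (cong (0ℚ ∷_) comb≡0))

-- One step of Gaussian elimination: the pivot w i₀ clears the first coordinate of the other vectors.
module Pivot {d m} (w : Fin (suc m) → Vecℚ (suc d)) (i₀ : Fin (suc m))
             (pivot≢0 : lookup (w i₀) zero ≢ 0ℚ) where

  private instance _ = ≢-nonZero pivot≢0

  factor : Fin m → ℚ
  factor j = - (lookup (w (punchIn i₀ j)) zero * 1/ lookup (w i₀) zero)

  reduced : Fin m → Vecℚ (suc d)
  reduced j = w (punchIn i₀ j) +v (factor j ·v w i₀)

  lookup-reduced : ∀ j l → lookup (reduced j) l ≡ lookup (w (punchIn i₀ j)) l + factor j * lookup (w i₀) l
  lookup-reduced j l =
    trans (lookup-+v (w (punchIn i₀ j)) _ l) (cong (lookup (w (punchIn i₀ j)) l +_) (lookup-·v (factor j) (w i₀) l))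

  reduced-head : ∀ j → lookup (reduced j) zero ≡ 0ℚ
  reduced-head j = begin
    lookup (reduced j) zero
      ≡⟨ lookup-reduced j zero ⟩
    h + - (h * 1/ p) * p
      ≡⟨ solve 3 (λ h q p → h :+ :- (h :* q) :* p := h :+ :- (h :* (q :* p))) refl h (1/ p) p ⟩
    h + - (h * (1/ p * p))
      ≡⟨ cong (λ x → h + - (h * x)) (*-inverseˡ p) ⟩
    h + - (h * 1ℚ)
      ≡⟨ solve 1 (λ h → h :+ :- (h :* con 1ℚ) := con 0ℚ) refl h ⟩
    0ℚ ∎
    where
    h = lookup (w (punchIn i₀ j)) zero
    p = lookup (w i₀) zero

  lincomb-reduced : ∀ a → lincomb m a reduced
                            ≡ lincomb (suc m) (Vector.insertAt a i₀ (∑[ j < m ] (a j * factor j))) w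
  lincomb-reduced a = trans (lincomb-+·v m a factor (Vector.removeAt w i₀) (w i₀))
                            (sym (lincomb-insertAt m a i₀ _ w))

  unreduce : ∀ j → w (punchIn i₀ j) ≡ ((- factor j) ·v w i₀) +v reduced j
  unreduce j = lookup-ext λ l → begin
    lookup (w (punchIn i₀ j)) l
      ≡⟨ solve 3 (λ x r y → x := :- r :* y :+ (x :+ r :* y))
                 refl (lookup (w (punchIn i₀ j)) l) (factor j) (lookup (w i₀) l) ⟩
    - factor j * lookup (w i₀) l + (lookup (w (punchIn i₀ j)) l + factor j * lookup (w i₀) l)
      ≡⟨ cong₂ _+_ (lookup-·v (- factor j) (w i₀) l) (lookup-reduced j l) ⟨
    lookup ((- factor j) ·v w i₀) l + lookup (reduced j) l
      ≡⟨ lookup-+v ((- factor j) ·v w i₀) (reduced j) l ⟨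
    lookup (((- factor j) ·v w i₀) +v reduced j) l ∎

pivot-or-headless : ∀ {d m} (w : Fin m → Vecℚ (suc d)) →
                    (∃[ i₀ ] lookup (w i₀) zero ≢ 0ℚ) ⊎ (∀ i → lookup (w i) zero ≡ 0ℚ)
pivot-or-headless w with any? (λ i → ¬? (lookup (w i) zero ≟ 0ℚ))
... | yes pivot   = inj₁ pivot
... | no no-pivot = inj₂ λ i → decidable-stable (lookup (w i) zero ≟ 0ℚ) (λ h≢0 → no-pivot (i , h≢0))

independent⇒≤dim : ∀ d m (w : Fin m → Vecℚ d) → LinIndep m w → m ℕ.≤ d
independent⇒≤dim d       zero    w _ = z≤n
independent⇒≤dim zero    (suc m) w w-indep with () ← w-indep (λ _ → 1ℚ) (lookup-ext λ ()) zero
independent⇒≤dim (suc d) (suc m) w w-indep with pivot-or-headless w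
... | inj₁ (i₀ , pivot≢0) =
  s≤s (independent⇒≤dim d m (tail ∘ reduced) (tail-independent {w = reduced} reduced-head reduced-independent))
  where
  open Pivot w i₀ pivot≢0
  reduced-independent : LinIndep m reduced
  reduced-independent a comb≡0 j = begin
    a j                              ≡⟨ insertAt-punchIn a i₀ s j ⟨
    a′ (punchIn i₀ j)                ≡⟨ w-indep a′ (trans (sym (lincomb-reduced a)) comb≡0) (punchIn i₀ j) ⟩
    0ℚ                               ∎
    where
    s  = ∑[ j < m ] (a j * factor j)
    a′ = Vector.insertAt a i₀ s
... | inj₂ heads≡0 =
  m≤n⇒m≤1+n (independent⇒≤dim d (suc m) (tail ∘ w) (tail-independent {w = w} heads≡0 w-indep))

independent-in-span⇒≤ : ∀ {d k m} (b : Fin k → Vecℚ d) (w : Fin m → Vecℚ d) →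
                        (∀ i → InSpanOf b (w i)) → LinIndep m w → m ℕ.≤ k
independent-in-span⇒≤ {k = k} {m} b w w∈b w-indep = independent⇒≤dim k m coords coords-independent
  where
  C : Fin m → Fin k → ℚ
  C = proj₁ ∘ w∈b
  coords : Fin m → Vecℚ k
  coords i = Vec.tabulate (C i)
  coords-independent : LinIndep m coords
  coords-independent a comb≡0 = w-indep a (begin
    lincomb m a w                                  ≡⟨ lincomb-cong m (λ _ → refl) (proj₂ ∘ w∈b) ⟩
    lincomb m a (λ i → lincomb k (C i) b)          ≡⟨ lincomb-lincomb m k a C b ⟩
    lincomb k (λ l → ∑[ i < m ] (a i * C i l)) b   ≡⟨ lincomb-cong k column≡0 (λ _ → refl) ⟩
    lincomb k (λ _ → 0ℚ) b                         ≡⟨ lincomb-zeroˡ k b ⟩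
    0v                                             ∎)
    where
    column≡0 : ∀ l → ∑[ i < m ] (a i * C i l) ≡ 0ℚ
    column≡0 l = begin
      ∑[ i < m ] (a i * C i l)                ≡⟨ sum-cong-≗ (λ i → cong (a i *_) (lookup∘tabulate (C i) l)) ⟨
      ∑[ i < m ] (a i * lookup (coords i) l)  ≡⟨ lookup-lincomb m a coords l ⟨
      lookup (lincomb m a coords) l           ≡⟨ cong (λ x → lookup x l) comb≡0 ⟩
      lookup 0v l                             ≡⟨ lookup-replicate l 0ℚ ⟩
      0ℚ                                      ∎

record Basis {d m} (L : Fin m → Vecℚ d) : Set where
  field
    size        : ℕ
    vector      : Fin size → Vecℚ d
    independent : LinIndep size vector
    in-span     : ∀ i → InSpanOf L (vector i)
    spanning    : ∀ i → InSpanOf vector (L i)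

headless-basis : ∀ {d m} (L : Fin m → Vecℚ (suc d)) → (∀ i → lookup (L i) zero ≡ 0ℚ) →
                 Basis (tail ∘ L) → Basis L
headless-basis {m = m} L heads≡0 B = record
  { size        = size
  ; vector      = λ i → 0ℚ ∷ vector i
  ; independent = 0∷-independent independent
  ; in-span     = λ i → let (a , e) = in-span i in
      a , trans (cong (0ℚ ∷_) e) (sym (lincomb-headless m a L heads≡0))
  ; spanning    = λ i → let (a , e) = spanning i in
      a , trans (≡0∷tail (L i) (heads≡0 i)) (trans (cong (0ℚ ∷_) e) (sym (lincomb-0∷ size a vector)))
  }
  where open Basis B

pivot-basis : ∀ {d m} (L : Fin (suc m) → Vecℚ (suc d)) i₀ (pivot≢0 : lookup (L i₀) zero ≢ 0ℚ) →
              Basis (tail ∘ Pivot.reduced L i₀ pivot≢0) → Basis L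
pivot-basis {m = m} L i₀ pivot≢0 B = record
  { size        = suc size
  ; vector      = vector′
  ; independent = ∷-independent (λ x → lookup x zero) head-linear (λ _ → refl) pivot≢0
                                (0∷-independent independent)
  ; in-span     = λ where
      zero    → span-member L i₀
      (suc i) → 0∷vector-in-span i
  ; spanning    = spanning′
  }
  where
  open Basis B
  open Pivot L i₀ pivot≢0

  vector′ : Fin (suc size) → Vecℚ (suc _)
  vector′ = L i₀ Vector.∷ λ i → 0ℚ ∷ vector i

  0∷vector-in-span : ∀ i → InSpanOf L (0ℚ ∷ vector i)
  0∷vector-in-span i = let (a , e) = in-span i in
    Vector.insertAt a i₀ (∑[ j < m ] (a j * factor j)) ,
    trans (cong (0ℚ ∷_) e) (trans (sym (lincomb-headless m a reduced reduced-head)) (lincomb-reduced a))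

  reduced-in-span : ∀ j → InSpanOf vector′ (L (punchIn i₀ j))
  reduced-in-span j = let (a , e) = spanning j in
    ((- factor j) Vector.∷ a) ,
    trans (unreduce j) (cong (((- factor j) ·v L i₀) +v_) (begin
      reduced j                        ≡⟨ ≡0∷tail (reduced j) (reduced-head j) ⟩
      0ℚ ∷ tail (reduced j)            ≡⟨ cong (0ℚ ∷_) e ⟩
      0ℚ ∷ lincomb size a vector       ≡⟨ lincomb-0∷ size a vector ⟨
      lincomb size a (λ i → 0ℚ ∷ vector i) ∎))

  spanning′ : ∀ i → InSpanOf vector′ (L i)
  spanning′ i with i₀ Fin.≟ i
  ... | yes refl  = span-member vector′ zero
  ... | no i₀≢i = subst (InSpanOf vector′) (cong L (punchIn-punchOut i₀≢i)) (reduced-in-span (punchOut i₀≢i))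

basis : ∀ d m (L : Fin m → Vecℚ d) → Basis L
basis zero    m L = record
  { size = 0 ; vector = λ () ; independent = λ _ _ () ; in-span = λ ()
  ; spanning = λ _ → (λ ()) , lookup-ext (λ ()) }
basis (suc d) m L with pivot-or-headless L
... | inj₁ (i₀ , pivot≢0) = at-pivot i₀ pivot≢0
  where
  at-pivot : ∀ {m} {L : Fin m → Vecℚ (suc d)} i₀ (pivot≢0 : lookup (L i₀) zero ≢ 0ℚ) → Basis L
  at-pivot {suc m} {L} i₀ pivot≢0 = pivot-basis L i₀ pivot≢0 (basis d m (tail ∘ Pivot.reduced L i₀ pivot≢0))
... | inj₂ heads≡0 = headless-basis L heads≡0 (basis d m (tail ∘ L))

-- Dimension of cones

span-trans : ∀ {d m k} {L : Fin m → Vecℚ d} {b : Fin k → Vecℚ d} →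
             (∀ i → InSpanOf b (L i)) → InSpanOf L ⊆ InSpanOf b
span-trans L⊆b (a , v≡aL) = subst (InSpanOf _) (sym v≡aL) (span-lincomb a L⊆b)

lincomb-singleton : ∀ {d} (x : Vecℚ d) → x ≡ lincomb 1 (λ _ → 1ℚ) (λ _ → x)
lincomb-singleton x = proj₂ (span-member (λ (_ : Fin 1) → x) zero)

⊆-InCone : ∀ {d} {U : Pred (Vecℚ d) Level.zero} → U ⊆ InCone U
⊆-InCone {x = x} x∈U =
  1 , (λ _ → 1ℚ) , (λ _ → x) , (λ _ → nonNegative⁻¹ 1ℚ) , (λ _ → x∈U) , lincomb-singleton x

⊆-InSpan : ∀ {d} {S : Pred (Vecℚ d) Level.zero} → S ⊆ InSpan S
⊆-InSpan {x = x} x∈S = 1 , (λ _ → 1ℚ) , (λ _ → x) , (λ _ → x∈S) , lincomb-singleton x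

cone-mono : ∀ {d} {U V : Pred (Vecℚ d) Level.zero} → U ⊆ V → InCone U ⊆ InCone V
cone-mono U⊆V (m , a , w , a≥0 , w∈U , e) = m , a , w , a≥0 , (λ i → U⊆V (w∈U i)) , e

coneSpan-mono : ∀ {d} {U V : Pred (Vecℚ d) Level.zero} → U ⊆ V → InSpan (InCone U) ⊆ InSpan (InCone V)
coneSpan-mono {U = U} {V} U⊆V (m , a , w , w∈cone , e) =
  m , a , w , (λ i → cone-mono {U = U} {V} U⊆V (w∈cone i)) , e

coneDim-cong : ∀ {d} {U V : Pred (Vecℚ d) Level.zero} {k} → U ≐ V → ConeDim U k → ConeDim V k
coneDim-cong {U = U} {V} (U⊆V , V⊆U) ((b , b∈ , b-indep) , maximal) =
  (b , (λ i → coneSpan-mono {U = U} {V} U⊆V (b∈ i)) , b-indep) ,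
  λ w w∈ → maximal w (λ i → coneSpan-mono {U = V} {U} V⊆U (w∈ i))

linear-vanishing-on-span : ∀ {d} (φ : Vecℚ d → ℚ) → Linear φ → ∀ {U : Pred (Vecℚ d) Level.zero} →
                           (∀ {x} → U x → φ x ≡ 0ℚ) → ∀ {v} → InSpan (InCone U) v → φ v ≡ 0ℚ
linear-vanishing-on-span φ lin {U} φU≡0 (m , a , w , w∈cone , refl) =
  linear-vanishing φ lin m a w (λ i → on-cone (w∈cone i))
  where
  on-cone : ∀ {v} → InCone U v → φ v ≡ 0ℚ
  on-cone (m′ , a′ , w′ , _ , w′∈U , refl) = linear-vanishing φ lin m′ a′ w′ (λ i → φU≡0 (w′∈U i))

IndependentAtMost : ∀ {d} → Pred (Vecℚ d) Level.zero → ℕ → Set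
IndependentAtMost {d} S k = ∀ {m} (w : Fin m → Vecℚ d) → (∀ i → S (w i)) → LinIndep m w → m ℕ.≤ k

coneDim-of-enumerated : ∀ {d} (U : Pred (Vecℚ d) Level.zero) (xs : List (Vecℚ d)) →
                        (∀ {x} → x ∈ xs → U x) → (∀ {x} → U x → x ∈ xs) →
                        ∃[ k ] ConeDim U k × IndependentAtMost (InSpan (InCone U)) k
coneDim-of-enumerated {d} U xs xs⊆U U⊆xs =
  size , ((vector , (λ i → span⊆coneSpan (in-span i)) , independent) ,
          (λ w w∈ w-indep → <-irrefl refl (bound w w∈ w-indep))) , bound
  where
  L = List.lookup xs
  open Basis (basis d (length xs) L)

  U⊆span : U ⊆ InSpanOf L
  U⊆span x∈U = let x∈xs = U⊆xs x∈U in
    subst (InSpanOf L) (sym (lookup-index x∈xs)) (span-member L (Any.index x∈xs))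

  coneSpan⊆span : InSpan (InCone U) ⊆ InSpanOf L
  coneSpan⊆span (m , a , w , w∈cone , refl) = span-lincomb a (λ i → on-cone (w∈cone i))
    where
    on-cone : InCone U ⊆ InSpanOf L
    on-cone (m′ , a′ , w′ , _ , w′∈U , refl) = span-lincomb a′ (λ i → U⊆span (w′∈U i))

  span⊆coneSpan : InSpanOf L ⊆ InSpan (InCone U)
  span⊆coneSpan (a , e) = length xs , a , L , (λ i → ⊆-InCone {U = U} (xs⊆U (∈-lookup i))) , e

  bound : IndependentAtMost (InSpan (InCone U)) size
  bound w w∈ = independent-in-span⇒≤ vector w (λ i → span-trans spanning (coneSpan⊆span (w∈ i)))

coneDim-< : ∀ {d} {U V : Pred (Vecℚ d) Level.zero} {k k′} (φ : Vecℚ d → ℚ) → Linear φ →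
            V ⊆ U → (∀ {x} → V x → φ x ≡ 0ℚ) → ∀ {v} → U v → φ v ≢ 0ℚ →
            ConeDim V k′ → IndependentAtMost (InSpan (InCone U)) k → k′ ℕ.< k
coneDim-< {U = U} {V} φ lin V⊆U φV≡0 {v} v∈U φv≢0 ((b , b∈ , b-indep) , _) bound =
  bound (v Vector.∷ b) v∷b∈
        (∷-independent φ lin (λ i → linear-vanishing-on-span φ lin φV≡0 (b∈ i)) φv≢0 b-indep)
  where
  v∷b∈ : ∀ i → InSpan (InCone U) ((v Vector.∷ b) i)
  v∷b∈ zero    = ⊆-InSpan {S = InCone U} (⊆-InCone {U = U} v∈U)
  v∷b∈ (suc i) = coneSpan-mono {U = V} {U} V⊆U (b∈ i)

-- Paths and simple cycles

Unique-lookup-injective : ∀ {A : Set} {xs : List A} → Unique xs →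
                          ∀ {i j} → List.lookup xs i ≡ List.lookup xs j → i ≡ j
Unique-lookup-injective (_   ∷ _) {zero}  {zero}  _  = refl
Unique-lookup-injective (x∉ ∷ _) {zero}  {suc j} eq = ⊥-elim (All.lookup x∉ (∈-lookup j) eq)
Unique-lookup-injective (x∉ ∷ _) {suc i} {zero}  eq = ⊥-elim (All.lookup x∉ (∈-lookup i) (sym eq))
Unique-lookup-injective (_   ∷ u) {suc i} {suc j} eq = cong suc (Unique-lookup-injective u eq)

Unique-length≤ : ∀ {n} {xs : List (Fin n)} → Unique xs → length xs ℕ.≤ n
Unique-length≤ {n} {xs} u with length xs ℕ.≤? n
... | yes ≤n = ≤n
... | no  ≰n with i , j , i<j , eq ← pigeonhole (≰⇒> ≰n) (List.lookup xs) =
  ⊥-elim (<⇒≢ i<j (Unique-lookup-injective u eq))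

listsUpTo : ∀ {A : Set} → ℕ → List A → List (List A)
listsUpTo zero    xs = [] ∷ []
listsUpTo (suc N) xs = [] ∷ List.cartesianProductWith _∷_ xs (listsUpTo N xs)

∈-listsUpTo : ∀ {A : Set} {xs ys : List A} N → All (_∈ xs) ys → length ys ℕ.≤ N → ys ∈ listsUpTo N xs
∈-listsUpTo zero    []             _         = here refl
∈-listsUpTo (suc N) []             _         = here refl
∈-listsUpTo (suc N) (y∈xs ∷ ys∈xs) (s≤s ≤N) =
  there (∈-cartesianProductWith⁺ _∷_ y∈xs (∈-listsUpTo N ys∈xs ≤N))

module _ {d n : ℕ} where

  PathIn-mono : ∀ {G H : Graph d n} → Tr G ⊆ Tr H → ∀ {p ts q} → PathIn G p ts q → PathIn H p ts q
  PathIn-mono G⊆H (one t∈G)       = one (G⊆H t∈G)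
  PathIn-mono G⊆H (step t∈G rest) = step (G⊆H t∈G) (PathIn-mono G⊆H rest)

  PathIn-All : ∀ {G : Graph d n} {p ts q} → PathIn G p ts q → All (Tr G) ts
  PathIn-All (one t∈G)       = t∈G ∷ []
  PathIn-All (step t∈G rest) = t∈G ∷ PathIn-All rest

  _++ᴾ_ : ∀ {G : Graph d n} {p ts q us r} → PathIn G p ts q → PathIn G q us r → PathIn G p (ts ++ us) r
  one t∈G       ++ᴾ P = step t∈G P
  step t∈G rest ++ᴾ P = step t∈G (rest ++ᴾ P)

  map-src : ∀ {G : Graph d n} {p ts q} → PathIn G p ts q → List.map src ts ≡ p ∷ inner ts
  map-src          (one _)                  = refl
  map-src {p = p} (step _ rest@(one _))    = cong (p ∷_) (map-src rest)
  map-src {p = p} (step _ rest@(step _ _)) = cong (p ∷_) (map-src rest)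

  inner-∷ : ∀ {G : Graph d n} {t ts r} → PathIn G (tgt t) ts r → inner (t ∷ ts) ≡ List.map src ts
  inner-∷ P@(one _)    = sym (map-src P)
  inner-∷ P@(step _ _) = sym (map-src P)

  SourceSimple : ∀ {G : Graph d n} {p ts q} → PathIn G p ts q → Set
  SourceSimple {ts = ts} _ = Unique (List.map src ts)

  suffix-from : ∀ {G : Graph d n} {p ts q x} → (P : PathIn G p ts q) → x ∈ List.map src ts → SourceSimple P →
                ∃[ ts′ ] Σ (PathIn G x ts′ q) SourceSimple
  suffix-from P@(one _)         (here refl) u       = _ , P , u
  suffix-from P@(step _ _)      (here refl) u       = _ , P , u
  suffix-from (step _ rest)     (there x∈)  (_ ∷ u) = suffix-from rest x∈ u

  shortcut : ∀ {G : Graph d n} {p ts q} → PathIn G p ts q → ∃[ ts′ ] Σ (PathIn G p ts′ q) SourceSimple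
  shortcut (one t∈G) = _ , one t∈G , [] ∷ []
  shortcut {p = p} (step t∈G rest) with shortcut rest
  ... | ts′ , P′ , u′ with Any.any? (p Fin.≟_) (List.map src ts′)
  ...   | yes p∈ = suffix-from P′ p∈ u′
  ...   | no  p∉ = _ , step t∈G P′ , ¬Any⇒All¬ _ p∉ ∷ u′

  PathIn? : ∀ {G : Graph d n} → Decidable (Tr G) → ∀ p ts q → Dec (PathIn G p ts q)
  PathIn? G? p [] q = no λ ()
  PathIn? G? p ((p′ , u , r) ∷ []) q with p Fin.≟ p′ | r Fin.≟ q | G? (p′ , u , r)
  ... | yes refl | yes refl | yes t∈G = yes (one t∈G)
  ... | no  p≢p′ | _        | _       = no λ { (one _) → p≢p′ refl }
  ... | yes refl | no  r≢q  | _       = no λ { (one _) → r≢q refl }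
  ... | yes refl | yes refl | no  t∉G = no λ { (one t∈G) → t∉G t∈G }
  PathIn? G? p ((p′ , u , r) ∷ t ∷ ts) q with p Fin.≟ p′ | G? (p′ , u , r) | PathIn? G? r (t ∷ ts) q
  ... | yes refl | yes t∈G | yes rest  = yes (step t∈G rest)
  ... | no  p≢p′ | _       | _         = no λ { (step _ _) → p≢p′ refl }
  ... | yes refl | no  t∉G | _         = no λ { (step t∈G _) → t∉G t∈G }
  ... | yes refl | yes _   | no  ¬rest = no λ { (step _ rest) → ¬rest rest }

  simpleCycle-length : ∀ {G : Graph d n} {p ts} → SimpleCycle G p ts → length ts ℕ.≤ suc n
  simpleCycle-length {ts = ts} (P , u) =
    subst (ℕ._≤ suc n) (trans (cong length (sym (map-src P))) (length-map src ts)) (s≤s (Unique-length≤ u))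

Trans-≟ : ∀ {d n} → DecidableEquality (Trans d n)
Trans-≟ = Product.≡-dec Fin._≟_ (Product.≡-dec (Vec.≡-dec ℤ._≟_) Fin._≟_)

_∈ᵀ?_ : ∀ {d n} (t : Trans d n) (T : List (Trans d n)) → Dec (t ∈ T)
t ∈ᵀ? T = DecMembership._∈?_ Trans-≟ t T

module _ {d n} {G : Graph d n} (G? : Decidable (Tr G)) (T : List (Trans d n)) (G⊆T : Tr G ⊆ (_∈ T)) where

  Inc-enumerable : ∃[ xs ] (∀ {x} → x ∈ xs → Inc G x) × (Inc G ⊆ (_∈ xs))
  Inc-enumerable = List.map effectℚ (filter isSimpleCycle? (listsUpTo (suc n) T)) , enumerated , complete
    where
    effectℚ : List (Trans d n) → Vecℚ d
    effectℚ ts = Vec.map toℚ (effect ts)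
    isSimpleCycle? : Decidable (λ ts → ∃[ p ] SimpleCycle G p ts)
    isSimpleCycle? ts = any? λ p → PathIn? G? p ts p ×-dec unique? Fin._≟_ (inner ts)
    enumerated : ∀ {x} → x ∈ List.map effectℚ (filter isSimpleCycle? (listsUpTo (suc n) T)) → Inc G x
    enumerated x∈ with ts , ts∈ , refl ← ∈-map⁻ effectℚ x∈ =
      let p , cycle = proj₂ (∈-filter⁻ isSimpleCycle? ts∈) in p , ts , cycle , refl
    complete : Inc G ⊆ (_∈ List.map effectℚ (filter isSimpleCycle? (listsUpTo (suc n) T)))
    complete (p , ts , cycle , refl) = ∈-map⁺ effectℚ (∈-filter⁺ isSimpleCycle?
      (∈-listsUpTo (suc n) (All.map G⊆T (PathIn-All (proj₁ cycle))) (simpleCycle-length cycle)) (p , cycle))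

  Inc-coneDim : ∃[ k ] ConeDim (Inc G) k × IndependentAtMost (InSpan (InCone (Inc G))) k
  Inc-coneDim = let xs , enumerated , complete = Inc-enumerable in
    coneDim-of-enumerated (Inc G) xs enumerated complete

-- Strongly connected components

Inc-mono : ∀ {d n} {G H : Graph d n} → Tr G ⊆ Tr H → Inc G ⊆ Inc H
Inc-mono G⊆H (p , ts , (P , u) , e) = p , ts , (PathIn-mono G⊆H P , u) , e

module Components {d n} {P : Trans d n → Set} (P? : Decidable P) (T : List (Trans d n)) (P⊆T : P ⊆ (_∈ T)) where

  H : Graph d n
  H = graphOn P

  Reachable : Fin n → Fin n → Set
  Reachable p q = ∃[ ts ] PathIn H p ts q

  reachable? : ∀ p q → Dec (Reachable p q)
  reachable? p q with Any.any? (λ ts → PathIn? P? p ts q) (listsUpTo n T)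
  ... | yes found = yes (Any.satisfied found)
  ... | no  none  = no λ (_ , P) → let ts , P′ , u = shortcut P in
    none (lose (∈-listsUpTo n (All.map P⊆T (PathIn-All P′))
                  (subst (ℕ._≤ n) (length-map src ts) (Unique-length≤ u))) P′)

  _▸_ : ∀ {p x u r} → Reachable p x → Tr H (x , u , r) → Reachable p r
  (ts , P) ▸ t∈H = _ , P ++ᴾ one t∈H

  _◂_ : ∀ {p ts q r} → PathIn H p ts q → Reachable q r → Reachable p r
  P ◂ (_ , Q) = _ , P ++ᴾ Q

  module _ (p₀ : Fin n) where

    SameComponent : Fin n → Set
    SameComponent x = Reachable p₀ x × Reachable x p₀

    component : Graph d n
    component = record
      { St = SameComponent
      ; Tr = λ t → Tr H t × SameComponent (src t) × SameComponent (tgt t) }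

    component? : Decidable (Tr component)
    component? t = P? t ×-dec ((reachable? p₀ (src t) ×-dec reachable? (src t) p₀)
                          ×-dec (reachable? p₀ (tgt t) ×-dec reachable? (tgt t) p₀))

    lift : ∀ {a ts b} → Reachable p₀ a → Reachable b p₀ → PathIn H a ts b → PathIn component a ts b
    lift p₀↝a b↝p₀ (one t∈H) =
      one (t∈H , (p₀↝a , one t∈H ◂ b↝p₀) , (p₀↝a ▸ t∈H , b↝p₀))
    lift p₀↝a b↝p₀ (step t∈H rest) =
      step (t∈H , (p₀↝a , step t∈H rest ◂ b↝p₀) , (p₀↝a ▸ t∈H , rest ◂ b↝p₀))
           (lift (p₀↝a ▸ t∈H) b↝p₀ rest)

    component-outgoing : ∀ x → SameComponent x → ∃[ u ] ∃[ q ] Tr component (x , u , q)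
    component-outgoing x x∼p₀@(p₀↝x , (_ , one {u = u} t∈H)) =
      u , p₀ , t∈H , x∼p₀ , (p₀↝x ▸ t∈H , p₀↝x ▸ t∈H)
    component-outgoing x x∼p₀@(p₀↝x , (_ , step {u = u} {r} t∈H rest)) =
      u , r , t∈H , x∼p₀ , (p₀↝x ▸ t∈H , (_ , rest))

    component-subVASS : Reachable p₀ p₀ → IsSubVASS component H
    component-subVASS loop =
      ((p₀ , loop , loop) , (λ _ t∈C → proj₂ t∈C) , component-outgoing) , (λ _ _ → _) , (λ _ → proj₁)

    component-stronglyConnected : StronglyConnected component
    component-stronglyConnected x y (p₀↝x , (_ , x↝p₀)) (p₀↝y@(_ , p₀↝y′) , y↝p₀) =
      _ , lift p₀↝x y↝p₀ (x↝p₀ ++ᴾ p₀↝y′)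

    SCC≐component : ∀ {A′ : Graph d n} → IsSCC A′ H → St A′ p₀ → Tr A′ ≐ Tr component
    SCC≐component {A′} (((_ , ends∈A′ , _) , _ , A′⊆H) , A′-connected , maximal) p₀∈A′ =
      A′⊆component , λ {t} → proj₂ (maximal component (component-subVASS (proj₁ (same p₀∈A′)))
                                       component-stronglyConnected (λ _ → same) (λ _ → A′⊆component)) t
      where
      inH : ∀ {p q} → St A′ p → St A′ q → Reachable p q
      inH p∈ q∈ = let ts , P = A′-connected _ _ p∈ q∈ in ts , PathIn-mono (A′⊆H _) P
      same : ∀ {x} → St A′ x → SameComponent x
      same x∈ = inH p₀∈A′ x∈ , inH x∈ p₀∈A′
      A′⊆component : Tr A′ ⊆ Tr component
      A′⊆component {t} t∈A′ =
        A′⊆H t t∈A′ , same (proj₁ (ends∈A′ t t∈A′)) , same (proj₂ (ends∈A′ t t∈A′))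

  -- Tr A′ need not be decidable, but it coincides with that of a decidable component.
  SCC-coneDim : ∀ {A′ : Graph d n} → IsSCC A′ H → ∃[ k ] ConeDim (Inc A′) k
  SCC-coneDim {A′} A′-scc@((((p₀ , p₀∈A′) , _) , _) , _) =
    let A′⊆C , C⊆A′ = SCC≐component p₀ A′-scc p₀∈A′
        k , C-dim , _ = Inc-coneDim (component? p₀) T (λ t∈C → P⊆T (proj₁ t∈C))
    in k , coneDim-cong {U = Inc (component p₀)} {Inc A′} (Inc-mono C⊆A′ , Inc-mono A′⊆C) C-dim

-- Quasi-ranking functions along cycles

-- toℚ normalises through a gcd computation, so additivity is proved in ℚᵘ.
toℚ-+ : ∀ a b → toℚ (a ℤ.+ b) ≡ toℚ a + toℚ b
toℚ-+ a b = toℚᵘ-injective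
  (ℚᵘ.≃-trans (toℚᵘ-fromℚᵘ (ℚᵘ.mkℚᵘ (a ℤ.+ b) 0))
  (ℚᵘ.≃-trans (ℚᵘ.*≡* (cong (ℤ._* ℤ.+ 1) (sym (cong₂ ℤ._+_ (ℤ.*-identityʳ a) (ℤ.*-identityʳ b)))))
  (ℚᵘ.≃-sym (ℚᵘ.≃-trans (toℚᵘ-homo-+ (toℚ a) (toℚ b))
                        (ℚᵘ.+-cong (toℚᵘ-fromℚᵘ (ℚᵘ.mkℚᵘ a 0)) (toℚᵘ-fromℚᵘ (ℚᵘ.mkℚᵘ b 0)))))))

dot-+ : ∀ {d} (c : Vecℚ d) (u v : Vecℤ d) → dot c (u +ℤv v) ≡ dot c u + dot c v
dot-+ []       []       []       = sym (+-identityʳ 0ℚ)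
dot-+ (c ∷ cs) (u ∷ us) (v ∷ vs) = begin
  c * toℚ (u ℤ.+ v) + dot cs (us +ℤv vs)
    ≡⟨ cong₂ (λ x y → c * x + y) (toℚ-+ u v) (dot-+ cs us vs) ⟩
  c * (toℚ u + toℚ v) + (dot cs us + dot cs vs)
    ≡⟨ solve 5 (λ c x y s t → c :* (x :+ y) :+ (s :+ t) := (c :* x :+ s) :+ (c :* y :+ t))
               refl c (toℚ u) (toℚ v) (dot cs us) (dot cs vs) ⟩
  (c * toℚ u + dot cs us) + (c * toℚ v + dot cs vs) ∎

dot-zero : ∀ {d} (c : Vecℚ d) → dot c (Vec.replicate d (ℤ.+ 0)) ≡ 0ℚ
dot-zero []       = refl
dot-zero (c ∷ cs) = trans (cong₂ _+_ (*-zeroʳ c) (dot-zero cs)) (+-identityʳ 0ℚ)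

dot-effect-one : ∀ {d n} (c : Vecℚ d) (t : Trans d n) → dot c (effect (t ∷ [])) ≡ dot c (eff t)
dot-effect-one c t = trans (dot-+ c (eff t) _) (trans (cong (dot c (eff t) +_) (dot-zero c)) (+-identityʳ _))

dotℚ : ∀ {d} → Vecℚ d → Vecℚ d → ℚ
dotℚ {d} c x = ∑[ j < d ] (lookup c j * lookup x j)

dotℚ-toℚ : ∀ {d} (c : Vecℚ d) (u : Vecℤ d) → dotℚ c (Vec.map toℚ u) ≡ dot c u
dotℚ-toℚ []       []       = refl
dotℚ-toℚ (c ∷ cs) (u ∷ us) = cong (c * toℚ u +_) (dotℚ-toℚ cs us)

dotℚ-linear : ∀ {d} (c : Vecℚ d) → Linear (dotℚ c)
dotℚ-linear {d} c m a w = begin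
  ∑[ j < d ] (lookup c j * lookup (lincomb m a w) j)
    ≡⟨ sum-cong-≗ (λ j → cong (lookup c j *_) (lookup-lincomb m a w j)) ⟩
  ∑[ j < d ] (lookup c j * ∑[ i < m ] (a i * lookup (w i) j))
    ≡⟨ sum-cong-≗ (λ j → *-distribˡ-sum (lookup c j) (λ i → a i * lookup (w i) j)) ⟩
  ∑[ j < d ] ∑[ i < m ] (lookup c j * (a i * lookup (w i) j))
    ≡⟨ ∑-comm (λ j i → lookup c j * (a i * lookup (w i) j)) ⟩
  ∑[ i < m ] ∑[ j < d ] (lookup c j * (a i * lookup (w i) j))
    ≡⟨ sum-cong-≗ (λ i → sum-cong-≗ (λ j →
         solve 3 (λ x y z → x :* (y :* z) := y :* (x :* z)) refl (lookup c j) (a i) (lookup (w i) j))) ⟩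
  ∑[ i < m ] ∑[ j < d ] (a i * (lookup c j * lookup (w i) j))
    ≡⟨ sum-cong-≗ (λ i → *-distribˡ-sum (a i) (λ j → lookup c j * lookup (w i) j)) ⟨
  ∑[ i < m ] (a i * dotℚ c (w i)) ∎

module Telescope {d n} (f : LinMap d n) {G : Graph d n} where

  effect-step : ∀ (p : Fin n) u (r : Fin n) ts x →
                dot (c f) (effect ((p , u , r) ∷ ts)) + x ≡ dot (c f) u + (dot (c f) (effect ts) + x)
  effect-step p u r ts x = trans (cong (_+ x) (dot-+ (c f) u (effect ts))) (+-assoc (dot (c f) u) _ x)

  neutral-path : Tr G ⊆ Neutral f → ∀ {p ts q} → PathIn G p ts q → dot (c f) (effect ts) + w f q ≡ w f p
  neutral-path G⊆N (one {p} {u} {q} t∈G) = trans (cong (_+ w f q) (dot-effect-one (c f) (p , u , q))) (G⊆N t∈G)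
  neutral-path G⊆N (step {p} {u} {r} {q} {ts} t∈G rest) = begin
    dot (c f) (effect ((p , u , r) ∷ ts)) + w f q  ≡⟨ effect-step p u r ts (w f q) ⟩
    dot (c f) u + (dot (c f) (effect ts) + w f q)  ≡⟨ cong (dot (c f) u +_) (neutral-path G⊆N rest) ⟩
    dot (c f) u + w f r                            ≡⟨ G⊆N t∈G ⟩
    w f p                                          ∎

  NonIncreasing : Trans d n → Set
  NonIncreasing t = Ranked f t ⊎ Neutral f t

  ranked-decreases : ∀ {p u q} → Ranked f (p , u , q) → dot (c f) u + w f q < w f p
  ranked-decreases {p} r = ≤-<-trans r p-1<p
    where
    p-1<p : w f p - 1ℚ < w f p
    p-1<p = <-≤-trans (+-monoʳ-< (w f p) (negative⁻¹ (- 1ℚ))) (≤-reflexive (+-identityʳ (w f p)))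

  nonIncreasing-≤ : ∀ {p u q} → NonIncreasing (p , u , q) → dot (c f) u + w f q ≤ w f p
  nonIncreasing-≤ (inj₁ r) = <⇒≤ (ranked-decreases r)
  nonIncreasing-≤ (inj₂ e) = ≤-reflexive e

  nonIncreasing-path : Tr G ⊆ NonIncreasing → ∀ {p ts q} → PathIn G p ts q →
                       dot (c f) (effect ts) + w f q ≤ w f p
  nonIncreasing-path G⊆NI (one {p} {u} {q} t∈G) =
    ≤-trans (≤-reflexive (cong (_+ w f q) (dot-effect-one (c f) (p , u , q)))) (nonIncreasing-≤ (G⊆NI t∈G))
  nonIncreasing-path G⊆NI (step {p} {u} {r} {q} {ts} t∈G rest) =
    ≤-trans (≤-reflexive (effect-step p u r ts (w f q)))
      (≤-trans (+-monoʳ-≤ (dot (c f) u) (nonIncreasing-path G⊆NI rest)) (nonIncreasing-≤ (G⊆NI t∈G)))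

  ranked-cycle-nonzero : Tr G ⊆ NonIncreasing → ∀ {p u q ts} → Ranked f (p , u , q) → PathIn G q ts p →
                         dot (c f) (effect ((p , u , q) ∷ ts)) ≢ 0ℚ
  ranked-cycle-nonzero G⊆NI {p} {u} {q} {ts} r P dot≡0 = ℚ.<-irrefl refl
    (≤-<-trans (≤-trans (≤-reflexive w≡) (+-monoʳ-≤ (dot (c f) u) (nonIncreasing-path G⊆NI P)))
               (ranked-decreases r))
    where
    w≡ : w f p ≡ dot (c f) u + (dot (c f) (effect ts) + w f p)
    w≡ = begin
      w f p                                          ≡⟨ +-identityˡ (w f p) ⟨
      0ℚ + w f p                                     ≡⟨ cong (_+ w f p) dot≡0 ⟨
      dot (c f) (effect ((p , u , q) ∷ ts)) + w f p  ≡⟨ effect-step p u q ts (w f p) ⟩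
      dot (c f) u + (dot (c f) (effect ts) + w f p)  ∎

neutral? : ∀ {d n} (f : LinMap d n) → Decidable (Neutral f)
neutral? f (p , u , q) = (dot (c f) u + w f q) ≟ w f p

neutral-transition? : ∀ {d n} (T : List (Trans d n)) (f : LinMap d n) → Decidable (NeutralTrans T f)
neutral-transition? T f t = t ∈ᵀ? T ×-dec neutral? f t

ranked-transition : ∀ {d n} {T : List (Trans d n)} {f : LinMap d n} → IsQRF T f →
                    ¬ (∀ t → t ∈ T → Neutral f t) → ∃[ t ] t ∈ T × Ranked f t
ranked-transition {T = T} {f} (_ , qrf) not-all-neutral
  with t , t∈T , ¬neutral ← find (¬All⇒Any¬ (neutral? f) T λ all → not-all-neutral (λ _ → All.lookup all))
  with qrf t t∈T
... | inj₁ ranked  = t , t∈T , ranked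
... | inj₂ neutral = ⊥-elim (¬neutral neutral)

neutral-cycle-vanishes : ∀ {d n} (f : LinMap d n) {G : Graph d n} → Tr G ⊆ Neutral f →
                         ∀ {v} → Inc G v → dotℚ (c f) v ≡ 0ℚ
neutral-cycle-vanishes f G⊆N (_ , ts , (P , _) , refl) =
  trans (dotℚ-toℚ (c f) (effect ts)) (identityˡ-unique _ _ (Telescope.neutral-path f G⊆N P))

ranked-simple-cycle : ∀ {d n} {T : List (Trans d n)} {f : LinMap d n} → IsQRF T f →
                      StronglyConnected (fullGraph T) → ∃[ t ] t ∈ T × Ranked f t →
                      ∃[ v ] Inc (fullGraph T) v × dotℚ (c f) v ≢ 0ℚ
ranked-simple-cycle {f = f} (_ , qrf) connected ((p , u , q) , t∈T , ranked)
  with ts , P ← connected q p _ _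
  with ts′ , P′ , sources-unique ← shortcut P =
  Vec.map toℚ (effect ((p , u , q) ∷ ts′)) ,
  (p , _ , (step t∈T P′ , subst Unique (sym (inner-∷ P′)) sources-unique) , refl) ,
  λ dot≡0 → Telescope.ranked-cycle-nonzero f (qrf _) ranked P′
              (trans (sym (dotℚ-toℚ (c f) (effect ((p , u , q) ∷ ts′)))) dot≡0)

mainTheorem7 : (d n : ℕ) (T : List (Trans d n)) → Unique T →
    IsVASS (fullGraph T) → StronglyConnected (fullGraph T) →
    (f : LinMap d n) (A′ : Graph d n) → MakesRecursiveCall T f A′ →
    Σ ℕ λ k → Σ ℕ λ k′ →
      ConeDim (Inc (fullGraph T)) k × ConeDim (Inc A′) k′ × (k′ ℕ.< k)
mainTheorem7 d n T _ _ connected f A′ ((qrf , _) , not-all-neutral , _ , A′-scc) =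
  let k , A-dim , A-bound = Inc-coneDim {G = fullGraph T} (_∈ᵀ? T) T (λ t∈T → t∈T)
      k′ , A′-dim = Components.SCC-coneDim (neutral-transition? T f) T proj₁ A′-scc
      v , v∈Inc , dot≢0 = ranked-simple-cycle qrf connected (ranked-transition qrf not-all-neutral)
  in k , k′ , A-dim , A′-dim ,
     coneDim-< {U = Inc (fullGraph T)} {Inc A′} (dotℚ (c f)) (dotℚ-linear (c f))
               (Inc-mono (λ {t} t∈A′ → proj₁ (A′⊆H t t∈A′)))
               (neutral-cycle-vanishes f (λ {t} t∈A′ → proj₂ (A′⊆H t t∈A′))) v∈Inc dot≢0 A′-dim A-bound
  where A′⊆H = proj₂ (proj₂ (proj₁ A′-scc))
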